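{- Let $n\ge 6$ be even. If $n\equiv 2\pmod 4$, no circulant or back-circulant Latin square of order $n$ with inner distance $\frac n2-1$ is a row product. If $n\equiv 0\pmod 4$, there are exactly $2$ circulant and exactly $2$ back-circulant Latin squares of order $n$ with inner distance $\frac n2-1$ and $m_{1,1}=1$ that are row products.
   Context: A Latin square of order $n$ has entries $m_{i,j}\in[1,n]$, each row and column containing each symbol once. $\mathrm{dist}(a,b)$ is the minimum of the residues in $[0,n-1]$ of $a-b$ and $b-a$ mod $n$; inner distance is the minimum $\mathrm{dist}$ over horizontally or vertically adjacent cells. Circulant: $m_{i+1,j+1}=m_{i,j}$ ($j<n$), $m_{i+1,1}=m_{i,n}$; back-circulant: $m_{i+1,j}=m_{i,j+1}$ ($j<n$), $m_{i+1,n}=m_{i,1}$. The horizontal difference matrix $H$ is the $n\times(n-1)$ matrix with $h_{i,j}\in[0,n-1]$, $h_{i,j}\equiv m_{i,j+1}-m_{i,j}\pmod n$; $L$ is a row product if all rows of $H$ are equal (equivalently $m_{i,j}\equiv s+\sum_{k<i}b_k+\sum_{k<j}a_k\pmod n$ for difference rows $(a_k),(b_k)$ of Latin rows and a constant $s$). -}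

module Defs where

open import Data.Nat using (ℕ; zero; suc; _+_; _∸_; _≤_; _⊔_; _⊓_; NonZero)
open import Data.Nat.DivMod using (_%_)
open import Data.Fin using (Fin; toℕ)
open import Data.Product using (_×_; Σ; ∃; ∃-syntax; _,_)
open import Data.Sum using (_⊎_)
open import Relation.Binary.PropositionalEquality using (_≡_)
open import Relation.Nullary using (¬_)

-- A square array of order n: rows/columns indexed by Fin n (row i of the
-- paper is Fin index i-1), entries are natural numbers (symbols 1..n).
Square : ℕ → Set
Square n = Fin n → Fin n → ℕ

record LatinSquare (n : ℕ) (M : Square n) : Set where
  field
    inRange  : ∀ i j → 1 ≤ M i j × M i j ≤ n
    rowOnto  : ∀ i s → 1 ≤ s → s ≤ n → ∃[ j ] M i j ≡ s
    rowInj   : ∀ i j j' → M i j ≡ M i j' → j ≡ j'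
    colOnto  : ∀ j s → 1 ≤ s → s ≤ n → ∃[ i ] M i j ≡ s
    colInj   : ∀ j i i' → M i j ≡ M i' j → i ≡ i'

-- residue in [0,n-1] of a - b mod n (for a, b ≤ n)
resDiff : (n : ℕ) .{{_ : NonZero n}} → ℕ → ℕ → ℕ
resDiff n a b = (a + n ∸ b) % n

dist : (n : ℕ) .{{_ : NonZero n}} → ℕ → ℕ → ℕ
dist n a b = resDiff n a b ⊓ resDiff n b a

Adjacent : {n : ℕ} → Fin n → Fin n → Fin n → Fin n → Set
Adjacent i j i' j' =
  (i ≡ i' × toℕ j' ≡ suc (toℕ j)) ⊎ (j ≡ j' × toℕ i' ≡ suc (toℕ i))

InnerDistance : (n : ℕ) .{{_ : NonZero n}} → Square n → ℕ → Set
InnerDistance n M d =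
  (∀ i j i' j' → Adjacent i j i' j' → d ≤ dist n (M i j) (M i' j'))
  × (Σ (Fin n) λ i → Σ (Fin n) λ j → Σ (Fin n) λ i' → Σ (Fin n) λ j' →
       Adjacent i j i' j' × dist n (M i j) (M i' j') ≡ d)

Circulant : (n : ℕ) → Square n → Set
Circulant n M =
  (∀ i i' j j' → toℕ i' ≡ suc (toℕ i) → toℕ j' ≡ suc (toℕ j) → M i' j' ≡ M i j)
  × (∀ i i' j₁ jₙ → toℕ i' ≡ suc (toℕ i) → toℕ j₁ ≡ 0 → toℕ jₙ ≡ n ∸ 1 →
       M i' j₁ ≡ M i jₙ)

BackCirculant : (n : ℕ) → Square n → Set
BackCirculant n M =
  (∀ i i' j j' → toℕ i' ≡ suc (toℕ i) → toℕ j' ≡ suc (toℕ j) → M i' j ≡ M i j')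
  × (∀ i i' j₁ jₙ → toℕ i' ≡ suc (toℕ i) → toℕ j₁ ≡ 0 → toℕ jₙ ≡ n ∸ 1 →
       M i' jₙ ≡ M i j₁)

hDiff : (n : ℕ) .{{_ : NonZero n}} → Square n → Fin n → Fin n → Fin n → ℕ
hDiff n M i j j' = resDiff n (M i j') (M i j)

RowProduct : (n : ℕ) .{{_ : NonZero n}} → Square n → Set
RowProduct n M =
  ∀ i i' j j' → toℕ j' ≡ suc (toℕ j) → hDiff n M i j j' ≡ hDiff n M i' j j'

TopLeftOne : (n : ℕ) → Square n → Set
TopLeftOne n M = ∀ i j → toℕ i ≡ 0 → toℕ j ≡ 0 → M i j ≡ 1

_≈S_ : {n : ℕ} → Square n → Square n → Set
A ≈S B = ∀ i j → A i j ≡ B i j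

ExactlyTwo : (n : ℕ) → (Square n → Set) → Set
ExactlyTwo n P =
  Σ (Square n) λ A → Σ (Square n) λ B →
    P A × P B × ¬ (A ≈S B) × (∀ C → P C → (C ≈S A) ⊎ (C ≈S B))

{-# OPTIONS --safe #-}
-- A circulant or back-circulant row product is affine: m i j ≡ s + i r + j c (mod n),
-- where c is the common horizontal difference and r = -c (circulant) or r = c
-- (back-circulant). Every pair of adjacent cells is then at distance
-- ‖ c ‖ = min (c, n - c), so inner distance k = n/2 - 1 forces c ≡ ± k.
-- If n ≡ 2 (mod 4), k is even, hence (n/2) c ≡ 0 and the first row repeats a symbol.
-- If n ≡ 0 (mod 4), k² ≡ 1 (mod n), so ± k are units and both affine squares with
-- m₁₁ = 1 are Latin; there are no others, since s, r and c determine an affine square.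
module Submission where

open import Defs
open import Data.Nat as ℕ using (ℕ; zero; suc; _≤_; _<_; _∸_; _⊓_; NonZero; z≤n; s≤s)
import Data.Nat.Properties as ℕP
open import Data.Nat.DivMod using (_%_; _/_; m%n<n; m<n⇒m%n≡m; m*n/n≡m; /-congˡ; m≡m%n+[m/n]*n)
open import Data.Nat.Divisibility using (_∣_)
import Data.Nat.Tactic.RingSolver as ℕ-Solver
open import Data.Integer using (ℤ; +_; +[1+_]; -[1+_]; _+_; _*_; -_; _-_; 0ℤ; 1ℤ; -1ℤ)
import Data.Integer.Properties as ℤP
open import Data.Integer.DivMod using (_%ℕ_; _/ℕ_; n%ℕd<d; a≡a%ℕn+[a/ℕn]*n)
open import Data.Integer.Tactic.RingSolver using (solve-∀)
open import Data.Fin as Fin using (Fin; toℕ; fromℕ<; inject₁)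
open import Data.Fin.Properties using (toℕ-fromℕ<; toℕ-injective; toℕ<n; toℕ-inject₁)
open import Data.Fin.Induction using (<-weakInduction)
open import Data.Product using (∃; _×_; _,_; proj₁; proj₂)
open import Data.Sum using (_⊎_; inj₁; inj₂; map)
open import Data.Empty using (⊥-elim)
open import Relation.Binary.PropositionalEquality
open import Relation.Binary.Bundles using (Setoid)
import Relation.Binary.Reasoning.Setoid as SetoidReasoning
open import Relation.Nullary using (¬_)
open import Function.Base using (_∘_)

Fin-induction : ∀ {m} (P : Fin m → Set) →
                (∀ j → toℕ j ≡ 0 → P j) →
                (∀ j j' → toℕ j' ≡ suc (toℕ j) → P j → P j') →
                ∀ j → P j
Fin-induction {zero}  _ _    _    ()
Fin-induction {suc m} P base step =
  <-weakInduction P (base Fin.zero refl)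
    (λ j → step (inject₁ j) (Fin.suc j) (cong suc (sym (toℕ-inject₁ j))))

pos-∸ : ∀ {a b} → b ≤ a → + (a ∸ b) ≡ + a - + b
pos-∸ {a} {b} b≤a = trans (sym (ℤP.⊖-≥ b≤a)) (sym (ℤP.m-n≡m⊖n a b))

module Modulo (n : ℕ) where

  infix 4 _≈_
  record _≈_ (x y : ℤ) : Set where
    constructor by-quotient
    field
      quotient : ℤ
      equation : x ≡ y + quotient * + n

  ≈-reflexive : ∀ {x y} → x ≡ y → x ≈ y
  ≈-reflexive {y = y} refl = by-quotient 0ℤ (sym (ℤP.+-identityʳ y))

  ≈-refl : ∀ {x} → x ≈ x
  ≈-refl = ≈-reflexive refl

  ≈-sym : ∀ {x y} → x ≈ y → y ≈ x
  ≈-sym {y = y} (by-quotient k eq) =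
    by-quotient (- k) (trans (undo y k (+ n)) (cong (λ x → x + - k * + n) (sym eq)))
    where
      undo : ∀ y k m → y ≡ (y + k * m) + - k * m
      undo = solve-∀

  ≈-trans : ∀ {x y z} → x ≈ y → y ≈ z → x ≈ z
  ≈-trans {z = z} (by-quotient k refl) (by-quotient l refl) = by-quotient (l + k) (collect z l k (+ n))
    where
      collect : ∀ z l k m → (z + l * m) + k * m ≡ z + (l + k) * m
      collect = solve-∀

  ≈-setoid : Setoid _ _
  ≈-setoid = record { Carrier = ℤ ; _≈_ = _≈_
                    ; isEquivalence = record { refl = ≈-refl ; sym = ≈-sym ; trans = ≈-trans } }

  module ≈-Reasoning = SetoidReasoning ≈-setoid

  +-cong : ∀ {x y u v} → x ≈ y → u ≈ v → x + u ≈ y + v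
  +-cong {y = y} {v = v} (by-quotient k refl) (by-quotient l refl) =
    by-quotient (k + l) (collect y v k l (+ n))
    where
      collect : ∀ y v k l m → (y + k * m) + (v + l * m) ≡ (y + v) + (k + l) * m
      collect = solve-∀

  *-cong : ∀ {x y u v} → x ≈ y → u ≈ v → x * u ≈ y * v
  *-cong {y = y} {v = v} (by-quotient k refl) (by-quotient l refl) =
    by-quotient (k * v + y * l + k * l * + n) (expand y v k l (+ n))
    where
      expand : ∀ y v k l m → (y + k * m) * (v + l * m) ≡ y * v + (k * v + y * l + k * l * m) * m
      expand = solve-∀

  -‿cong : ∀ {x y} → x ≈ y → - x ≈ - y
  -‿cong {y = y} (by-quotient k refl) = by-quotient (- k) (distrib y k (+ n))
    where
      distrib : ∀ y k m → - (y + k * m) ≡ - y + - k * m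
      distrib = solve-∀

  multiple≈0 : ∀ k → k * + n ≈ 0ℤ
  multiple≈0 k = by-quotient k (sym (ℤP.+-identityˡ (k * + n)))

  +-cancelˡ : ∀ {x y} z → z + x ≈ z + y → x ≈ y
  +-cancelˡ {x} {y} z z+x≈z+y = begin
    x               ≡⟨ cancel x z ⟩
    - z + (z + x)   ≈⟨ +-cong (≈-refl {x = - z}) z+x≈z+y ⟩
    - z + (z + y)   ≡⟨ sym (cancel y z) ⟩
    y               ∎
    where
      open ≈-Reasoning
      cancel : ∀ x z → x ≡ - z + (z + x)
      cancel = solve-∀

  +-moveʳ : ∀ {x y c} → x + c ≈ y → x ≈ y + - c
  +-moveʳ {x} {y} {c} x+c≈y = ≈-trans (≈-reflexive (cancel x c)) (+-cong x+c≈y (≈-refl {x = - c}))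
    where
      cancel : ∀ x c → x ≡ (x + c) + - c
      cancel = solve-∀

  step⇒diff : ∀ {x x' c} → x' ≈ x + c → x' - x ≈ c
  step⇒diff {x} {c = c} x'≈x+c = ≈-trans (+-cong x'≈x+c (≈-refl {x = - x})) (≈-reflexive (cancel x c))
    where
      cancel : ∀ x c → (x + c) - x ≡ c
      cancel = solve-∀

  neg-square≈1 : ∀ {c} → c * c ≈ 1ℤ → - c * - c ≈ 1ℤ
  neg-square≈1 {c} c²≈1 = ≈-trans (≈-reflexive (neg-square c)) c²≈1
    where
      neg-square : ∀ c → - c * - c ≡ c * c
      neg-square = solve-∀

  modulus≈0 : + n ≈ 0ℤ
  modulus≈0 = ≈-trans (≈-reflexive (sym (ℤP.*-identityˡ (+ n)))) (multiple≈0 1ℤ)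

  product≈0 : ∀ {a b} m → a ℕ.* b ≡ m ℕ.* n → + a * + b ≈ 0ℤ
  product≈0 {a} {b} m ab≡mn =
    ≈-trans (≈-reflexive (trans (sym (ℤP.pos-* a b)) (trans (cong +_ ab≡mn) (ℤP.pos-* m n))))
            (multiple≈0 (+ m))

  module _ .{{_ : NonZero n}} where

    %ℕ-≈ : ∀ x → + (x %ℕ n) ≈ x
    %ℕ-≈ x = ≈-sym (by-quotient (x /ℕ n) (a≡a%ℕn+[a/ℕn]*n x n))

    private
      modulus≤ : ∀ {a b} m → + a ≡ + b + +[1+ m ] * + n → n ≤ a
      modulus≤ {a} {b} m eq = begin
        n                   ≤⟨ ℕP.m≤n*m n (suc m) ⟩
        suc m ℕ.* n         ≤⟨ ℕP.m≤n+m _ b ⟩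
        b ℕ.+ suc m ℕ.* n   ≡⟨ ℤP.+-injective (trans (cong (_+_ (+ b)) (ℤP.pos-* (suc m) n)) (sym eq)) ⟩
        a                   ∎
        where open ℕP.≤-Reasoning

    <n-≈⇒≡ : ∀ {a b} → a < n → b < n → + a ≈ + b → a ≡ b
    <n-≈⇒≡ {b = b} _   _   (by-quotient (+ 0)    eq) = ℤP.+-injective (trans eq (ℤP.+-identityʳ (+ b)))
    <n-≈⇒≡         a<n _   (by-quotient +[1+ m ] eq) = ⊥-elim (ℕP.<⇒≱ a<n (modulus≤ m eq))
    <n-≈⇒≡         _   b<n (by-quotient -[1+ m ] eq) =
      ⊥-elim (ℕP.<⇒≱ b<n (modulus≤ m (_≈_.equation (≈-sym (by-quotient -[1+ m ] eq)))))

    %ℕ-cong : ∀ {x y} → x ≈ y → x %ℕ n ≡ y %ℕ n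
    %ℕ-cong {x} {y} x≈y =
      <n-≈⇒≡ (n%ℕd<d x n) (n%ℕd<d y n) (≈-trans (%ℕ-≈ x) (≈-trans x≈y (≈-sym (%ℕ-≈ y))))

    IsSymbol : ℕ → Set
    IsSymbol a = 1 ≤ a × a ≤ n

    symbol-≈⇒≡ : ∀ {a b} → IsSymbol a → IsSymbol b → + a ≈ + b → a ≡ b
    symbol-≈⇒≡ {suc a} {suc b} (_ , a<n) (_ , b<n) 1+a≈1+b =
      cong suc (<n-≈⇒≡ a<n b<n (+-cancelˡ 1ℤ 1+a≈1+b))

    resDiff≈ : ∀ {a b} → b ≤ n → + resDiff n a b ≈ + a - + b
    resDiff≈ {a} {b} b≤n = begin
      + resDiff n a b          ≈⟨ %ℕ-≈ (+ (a ℕ.+ n ∸ b)) ⟩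
      + (a ℕ.+ n ∸ b)          ≡⟨ pos-∸ (ℕP.≤-trans b≤n (ℕP.m≤n+m n a)) ⟩
      + a + + n - + b          ≈⟨ by-quotient 1ℤ (shift (+ a) (+ b) (+ n)) ⟩
      + a - + b                ∎
      where
        open ≈-Reasoning
        shift : ∀ a b m → a + m - b ≡ (a - b) + 1ℤ * m
        shift = solve-∀

    resDiff-step : ∀ {a b d} → b ≤ n → resDiff n a b ≡ d → + a ≈ + b + + d
    resDiff-step {a} {b} b≤n refl =
      ≈-trans (≈-reflexive (split (+ a) (+ b))) (+-cong (≈-refl {x = + b}) (≈-sym (resDiff≈ b≤n)))
      where
        split : ∀ a b → a ≡ b + (a - b)
        split = solve-∀

    resDiff≡%ℕ : ∀ {a b} → b ≤ n → resDiff n a b ≡ (+ a - + b) %ℕ n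
    resDiff≡%ℕ {a} {b} b≤n =
      <n-≈⇒≡ (m%n<n _ n) (n%ℕd<d (+ a - + b) n) (≈-trans (resDiff≈ b≤n) (≈-sym (%ℕ-≈ (+ a - + b))))

    ‖_‖ : ℤ → ℕ
    ‖ x ‖ = (x %ℕ n) ⊓ ((- x) %ℕ n)

    ‖‖-cong : ∀ {x y} → x ≈ y → ‖ x ‖ ≡ ‖ y ‖
    ‖‖-cong x≈y = cong₂ _⊓_ (%ℕ-cong x≈y) (%ℕ-cong (-‿cong x≈y))

    ‖-x‖≡‖x‖ : ∀ x → ‖ - x ‖ ≡ ‖ x ‖
    ‖-x‖≡‖x‖ x = trans (cong (λ y → ((- x) %ℕ n) ⊓ (y %ℕ n)) (ℤP.neg-involutive x)) (ℕP.⊓-comm _ _)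

    dist≡‖-‖ : ∀ {a b} → a ≤ n → b ≤ n → dist n a b ≡ ‖ + b - + a ‖
    dist≡‖-‖ {a} {b} a≤n b≤n = trans
      (cong₂ _⊓_ (trans (resDiff≡%ℕ b≤n) (cong (_%ℕ n) (swap (+ a) (+ b)))) (resDiff≡%ℕ a≤n))
      (ℕP.⊓-comm _ _)
      where
        swap : ∀ a b → a - b ≡ - (b - a)
        swap = solve-∀

    ‖+d‖ : ∀ {d} → 0 < d → d < n → ‖ + d ‖ ≡ d ⊓ (n ∸ d)
    ‖+d‖ {d} 0<d d<n = cong₂ _⊓_ (m<n⇒m%n≡m d<n) (<n-≈⇒≡ (n%ℕd<d (- + d) n) n∸d<n (begin
      + ((- + d) %ℕ n)   ≈⟨ %ℕ-≈ (- + d) ⟩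
      - + d              ≈⟨ by-quotient -1ℤ (wrap (+ d) (+ n)) ⟩
      + n - + d          ≡⟨ sym (pos-∸ (ℕP.<⇒≤ d<n)) ⟩
      + (n ∸ d)          ∎))
      where
        open ≈-Reasoning
        n∸d<n : n ∸ d < n
        n∸d<n = ℕP.∸-monoʳ-< 0<d (ℕP.<⇒≤ d<n)
        wrap : ∀ d m → - d ≡ (m - d) + - 1ℤ * m
        wrap = solve-∀

    ‖+d‖≡⇒ : ∀ {d K} → d < n → ‖ + d ‖ ≡ K → d ≡ K ⊎ d ℕ.+ K ≡ n
    ‖+d‖≡⇒ {zero} _ ‖0‖≡K = inj₁ (trans (sym ‖0‖≡0) ‖0‖≡K)
      where
        ‖0‖≡0 : ‖ 0ℤ ‖ ≡ 0
        ‖0‖≡0 = cong (λ r → r ⊓ r) (m<n⇒m%n≡m (ℕ.>-nonZero⁻¹ n))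
    ‖+d‖≡⇒ {suc d} {K} d<n ‖d‖≡K with ℕP.⊓-sel (suc d) (n ∸ suc d)
    ... | inj₁ min≡d   = inj₁ (trans (sym min≡d) (trans (sym (‖+d‖ (s≤s z≤n) d<n)) ‖d‖≡K))
    ... | inj₂ min≡n∸d = inj₂ (trans (cong (suc d ℕ.+_) (sym n∸d≡K)) (ℕP.m+[n∸m]≡n (ℕP.<⇒≤ d<n)))
      where
        n∸d≡K : n ∸ suc d ≡ K
        n∸d≡K = trans (sym min≡n∸d) (trans (sym (‖+d‖ (s≤s z≤n) d<n)) ‖d‖≡K)

data Symmetry : Set where
  circulant backCirculant : Symmetry

module Squares (n : ℕ) .{{_ : NonZero n}} (1<n : 1 < n) where
  open Modulo n

  fin₀ fin₁ finLast : Fin n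
  fin₀ = fromℕ< (ℕP.<-trans (s≤s z≤n) 1<n)
  fin₁ = fromℕ< 1<n
  finLast = fromℕ< (ℕP.∸-monoʳ-< (s≤s z≤n) (ℕP.<⇒≤ 1<n))

  toℕ-fin₀ : toℕ fin₀ ≡ 0
  toℕ-fin₀ = toℕ-fromℕ< _

  toℕ-fin₁ : toℕ fin₁ ≡ suc (toℕ fin₀)
  toℕ-fin₁ = trans (toℕ-fromℕ< _) (cong suc (sym toℕ-fin₀))

  toℕ-finLast : toℕ finLast ≡ n ∸ 1
  toℕ-finLast = toℕ-fromℕ< _

  zero-term : ∀ {a c} (j : Fin n) → toℕ j ≡ 0 → a ≡ a + + toℕ j * c
  zero-term {a} {c} j j≡0 = trans (sym (ℤP.+-identityʳ a)) (cong (λ t → a + + t * c) (sym j≡0))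

  InRange : Square n → Set
  InRange M = ∀ i j → IsSymbol (M i j)

  Unit : ℤ → Set
  Unit c = ∃ λ c⁻¹ → c⁻¹ * c ≈ 1ℤ

  unit-cancelʳ : ∀ {c x y} → Unit c → x * c ≈ y * c → x ≈ y
  unit-cancelʳ {c} {x} {y} (c⁻¹ , c⁻¹c≈1) xc≈yc = begin
    x                ≡⟨ sym (ℤP.*-identityʳ x) ⟩
    x * 1ℤ           ≈⟨ *-cong (≈-refl {x = x}) (≈-sym c⁻¹c≈1) ⟩
    x * (c⁻¹ * c)    ≡⟨ regroup x c⁻¹ c ⟩
    x * c * c⁻¹      ≈⟨ *-cong xc≈yc (≈-refl {x = c⁻¹}) ⟩
    y * c * c⁻¹      ≡⟨ sym (regroup y c⁻¹ c) ⟩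
    y * (c⁻¹ * c)    ≈⟨ *-cong (≈-refl {x = y}) c⁻¹c≈1 ⟩
    y * 1ℤ           ≡⟨ ℤP.*-identityʳ y ⟩
    y                ∎
    where
      open ≈-Reasoning
      regroup : ∀ x c⁻¹ c → x * (c⁻¹ * c) ≡ x * c * c⁻¹
      regroup = solve-∀

  unit-divide : ∀ {c} (u : Unit c) y → y * proj₁ u * c ≈ y
  unit-divide {c} (c⁻¹ , c⁻¹c≈1) y = begin
    y * c⁻¹ * c      ≡⟨ ℤP.*-assoc y c⁻¹ c ⟩
    y * (c⁻¹ * c)    ≈⟨ *-cong (≈-refl {x = y}) c⁻¹c≈1 ⟩
    y * 1ℤ           ≡⟨ ℤP.*-identityʳ y ⟩
    y                ∎
    where open ≈-Reasoning

  record Progression (f : Fin n → ℕ) (a c : ℤ) : Set where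
    constructor progression
    field
      term : ∀ j → + f j ≈ a + + toℕ j * c

  open Progression

  private
    peel : ∀ a t c → a + (1ℤ + t) * c ≡ (a + t * c) + c
    peel = solve-∀

  progression-step : ∀ {f a c} → Progression f a c →
                     ∀ {j j'} → toℕ j' ≡ suc (toℕ j) → + f j' ≈ + f j + c
  progression-step {f} {a} {c} P {j} {j'} j'≡1+j = begin
    + f j'                   ≈⟨ term P j' ⟩
    a + + toℕ j' * c         ≡⟨ cong (λ t → a + + t * c) j'≡1+j ⟩
    a + (1ℤ + + toℕ j) * c   ≡⟨ peel a (+ toℕ j) c ⟩
    a + + toℕ j * c + c      ≈⟨ +-cong (≈-sym (term P j)) (≈-refl {x = c}) ⟩
    + f j + c                ∎
    where open ≈-Reasoning

  progression-by-steps : ∀ {f a c} →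
                         (∀ j → toℕ j ≡ 0 → + f j ≈ a) →
                         (∀ j j' → toℕ j' ≡ suc (toℕ j) → + f j' ≈ + f j + c) →
                         Progression f a c
  progression-by-steps {f} {a} {c} base step = progression
    (Fin-induction (λ j → + f j ≈ a + + toℕ j * c)
      (λ j j≡0 → ≈-trans (base j j≡0) (≈-reflexive (zero-term j j≡0)))
      next)
    where
      open ≈-Reasoning
      next : ∀ j j' → toℕ j' ≡ suc (toℕ j) → + f j ≈ a + + toℕ j * c → + f j' ≈ a + + toℕ j' * c
      next j j' j'≡1+j fj≈ = begin
        + f j'                   ≈⟨ step j j' j'≡1+j ⟩
        + f j + c                ≈⟨ +-cong fj≈ (≈-refl {x = c}) ⟩
        a + + toℕ j * c + c      ≡⟨ sym (peel a (+ toℕ j) c) ⟩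
        a + (1ℤ + + toℕ j) * c   ≡⟨ cong (λ t → a + + t * c) (sym j'≡1+j) ⟩
        a + + toℕ j' * c         ∎

  progression-wrap : ∀ {f a c} → Progression f a c →
                     ∀ {j₁ jₙ} → toℕ j₁ ≡ 0 → toℕ jₙ ≡ n ∸ 1 → + f jₙ + c ≈ + f j₁
  progression-wrap {f} {a} {c} P {j₁} {jₙ} j₁≡0 jₙ≡n-1 = begin
    + f jₙ + c                   ≈⟨ +-cong (term P jₙ) (≈-refl {x = c}) ⟩
    a + + toℕ jₙ * c + c         ≡⟨ cong (λ t → a + + t * c + c) jₙ≡n-1 ⟩
    a + + (n ∸ 1) * c + c        ≡⟨ cong (λ t → a + t * c + c) (pos-∸ (ℕP.<⇒≤ 1<n)) ⟩
    a + (+ n - 1ℤ) * c + c       ≈⟨ by-quotient c (full-turn a c (+ n)) ⟩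
    a                            ≡⟨ zero-term j₁ j₁≡0 ⟩
    a + + toℕ j₁ * c             ≈⟨ ≈-sym (term P j₁) ⟩
    + f j₁                       ∎
    where
      open ≈-Reasoning
      full-turn : ∀ a c m → a + (m - 1ℤ) * c + c ≡ a + c * m
      full-turn = solve-∀

  progression-injective : ∀ {f a c} → Progression f a c → Unit c → ∀ j j' → f j ≡ f j' → j ≡ j'
  progression-injective {f} {a} {c} P u j j' fj≡fj' =
    toℕ-injective (<n-≈⇒≡ (toℕ<n j) (toℕ<n j') (unit-cancelʳ u (+-cancelˡ a (begin
      a + + toℕ j * c    ≈⟨ ≈-sym (term P j) ⟩
      + f j              ≡⟨ cong +_ fj≡fj' ⟩
      + f j'             ≈⟨ term P j' ⟩
      a + + toℕ j' * c   ∎))))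
    where open ≈-Reasoning

  progression-surjective : ∀ {f a c} → (∀ j → IsSymbol (f j)) → Progression f a c → Unit c →
                           ∀ t → 1 ≤ t → t ≤ n → ∃ λ j → f j ≡ t
  progression-surjective {f} {a} {c} symbols P u t 1≤t t≤n =
    j , symbol-≈⇒≡ (symbols j) (1≤t , t≤n) (begin
      + f j                ≈⟨ term P j ⟩
      a + + toℕ j * c      ≡⟨ cong (λ k → a + + k * c) (toℕ-fromℕ< (n%ℕd<d x n)) ⟩
      a + + (x %ℕ n) * c   ≈⟨ +-cong (≈-refl {x = a}) (*-cong (%ℕ-≈ x) (≈-refl {x = c})) ⟩
      a + x * c            ≈⟨ +-cong (≈-refl {x = a}) (unit-divide u (+ t - a)) ⟩
      a + (+ t - a)        ≡⟨ cancel a (+ t) ⟩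
      + t                  ∎)
    where
      open ≈-Reasoning
      x : ℤ
      x = (+ t - a) * proj₁ u
      j : Fin n
      j = fromℕ< (n%ℕd<d x n)
      cancel : ∀ a t → a + (t - a) ≡ t
      cancel = solve-∀

  progression-diff : ∀ {f a c} → Progression f a c →
                     ∀ {j j'} → toℕ j' ≡ suc (toℕ j) → + f j' - + f j ≈ c
  progression-diff {f} P {j} j'≡1+j = step⇒diff {x = + f j} (progression-step P j'≡1+j)

  record Affine (s r c : ℤ) (M : Square n) : Set where
    constructor affine
    field
      entry : ∀ i j → + M i j ≈ s + + toℕ i * r + + toℕ j * c

    row : ∀ i → Progression (M i) (s + + toℕ i * r) c
    row i = progression (entry i)

    column : ∀ j → Progression (λ i → M i j) (s + + toℕ j * c) r
    column j = progression λ i → ≈-trans (entry i j) (≈-reflexive (swap s (+ toℕ i * r) (+ toℕ j * c)))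
      where
        swap : ∀ s x y → s + x + y ≡ s + y + x
        swap = solve-∀

  affine-latin : ∀ {s r c M} → InRange M → Affine s r c M → Unit r → Unit c → LatinSquare n M
  affine-latin symbols A ur uc = record
    { inRange = symbols
    ; rowOnto = λ i → progression-surjective (symbols i) (Affine.row A i) uc
    ; rowInj  = λ i → progression-injective (Affine.row A i) uc
    ; colOnto = λ j → progression-surjective (λ i → symbols i j) (Affine.column A j) ur
    ; colInj  = λ j → progression-injective (Affine.column A j) ur
    }

  affine-unique : ∀ {s r c M s' r' c' M'} → InRange M → InRange M' →
                  Affine s r c M → Affine s' r' c' M' → s ≈ s' → r ≈ r' → c ≈ c' → M ≈S M'
  affine-unique {s} {r} {c} {M} {s'} {r'} {c'} {M'} symbols symbols' A A' s≈s' r≈r' c≈c' i j =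
    symbol-≈⇒≡ (symbols i j) (symbols' i j) (begin
      + M i j                              ≈⟨ Affine.entry A i j ⟩
      s + + toℕ i * r + + toℕ j * c        ≈⟨ +-cong (+-cong s≈s' (*-cong (≈-refl {x = + toℕ i}) r≈r'))
                                                     (*-cong (≈-refl {x = + toℕ j}) c≈c') ⟩
      s' + + toℕ i * r' + + toℕ j * c'     ≈⟨ ≈-sym (Affine.entry A' i j) ⟩
      + M' i j                             ∎)
    where open ≈-Reasoning

  affine-topLeft : ∀ {r c M} → InRange M → Affine 1ℤ r c M → TopLeftOne n M
  affine-topLeft {r} {c} symbols A i j i≡0 j≡0 = symbol-≈⇒≡ (symbols i j) (ℕP.≤-refl , ℕP.<⇒≤ 1<n)
    (≈-trans (Affine.entry A i j) (≈-reflexive (cong₂ (λ a b → 1ℤ + + a * r + + b * c) i≡0 j≡0)))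

  affine-hDiff : ∀ {s r c M} → InRange M → Affine s r c M →
                 ∀ i {j j'} → toℕ j' ≡ suc (toℕ j) → hDiff n M i j j' ≡ c %ℕ n
  affine-hDiff symbols A i {j} j'≡1+j =
    trans (resDiff≡%ℕ (proj₂ (symbols i j))) (%ℕ-cong (progression-diff (Affine.row A i) j'≡1+j))

  affine⇒rowProduct : ∀ {s r c M} → InRange M → Affine s r c M → RowProduct n M
  affine⇒rowProduct symbols A i i' j j' j'≡1+j =
    trans (affine-hDiff symbols A i j'≡1+j) (sym (affine-hDiff symbols A i' j'≡1+j))

  affine-≈S⇒slope≈ : ∀ {s r c M s' r' c' M'} → InRange M → InRange M' →
                     Affine s r c M → Affine s' r' c' M' → M ≈S M' → c ≈ c'
  affine-≈S⇒slope≈ {c = c} {M = M} {c' = c'} {M' = M'} symbols symbols' A A' M≈M' = begin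
    c                            ≈⟨ ≈-sym (%ℕ-≈ c) ⟩
    + (c %ℕ n)                   ≡⟨ cong +_ (sym (affine-hDiff symbols A fin₀ toℕ-fin₁)) ⟩
    + hDiff n M fin₀ fin₀ fin₁   ≡⟨ cong₂ (λ a b → + resDiff n a b) (M≈M' fin₀ fin₁)
                                                                      (M≈M' fin₀ fin₀) ⟩
    + hDiff n M' fin₀ fin₀ fin₁  ≡⟨ cong +_ (affine-hDiff symbols' A' fin₀ toℕ-fin₁) ⟩
    + (c' %ℕ n)                  ≈⟨ %ℕ-≈ c' ⟩
    c'                           ∎
    where open ≈-Reasoning

  affine-adjacent-dist : ∀ {s r c M} → InRange M → Affine s r c M → ‖ r ‖ ≡ ‖ c ‖ →
                         ∀ {i j i' j'} → Adjacent i j i' j' → dist n (M i j) (M i' j') ≡ ‖ c ‖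
  affine-adjacent-dist symbols A _ {i} {j} {j' = j'} (inj₁ (refl , j'≡1+j)) =
    trans (dist≡‖-‖ (proj₂ (symbols i j)) (proj₂ (symbols i j')))
          (‖‖-cong (progression-diff (Affine.row A i) j'≡1+j))
  affine-adjacent-dist symbols A ‖r‖≡‖c‖ {i} {j} {i'} (inj₂ (refl , i'≡1+i)) =
    trans (dist≡‖-‖ (proj₂ (symbols i j)) (proj₂ (symbols i' j)))
          (trans (‖‖-cong (progression-diff (Affine.column A j) i'≡1+i)) ‖r‖≡‖c‖)

  affine-innerDistance : ∀ {s r c M} → InRange M → Affine s r c M → ‖ r ‖ ≡ ‖ c ‖ →
                         InnerDistance n M ‖ c ‖
  affine-innerDistance symbols A ‖r‖≡‖c‖ =
    (λ i j i' j' adj → ℕP.≤-reflexive (sym (affine-adjacent-dist symbols A ‖r‖≡‖c‖ adj))) ,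
    fin₀ , fin₀ , fin₀ , fin₁ , horizontal , affine-adjacent-dist symbols A ‖r‖≡‖c‖ horizontal
    where
      horizontal : Adjacent fin₀ fin₀ fin₀ fin₁
      horizontal = inj₁ (refl , toℕ-fin₁)

  innerDistance-affine : ∀ {s r c M K} → InRange M → Affine s r c M → ‖ r ‖ ≡ ‖ c ‖ →
                         InnerDistance n M K → ‖ c ‖ ≡ K
  innerDistance-affine symbols A ‖r‖≡‖c‖ (_ , _ , _ , _ , _ , adj , dist≡K) =
    trans (sym (affine-adjacent-dist symbols A ‖r‖≡‖c‖ adj)) dist≡K

  latin-affine⇒t*c≈0⇒t≡0 : ∀ {s r c M} → LatinSquare n M → Affine s r c M →
                           ∀ {t} → t < n → + t * c ≈ 0ℤ → t ≡ 0
  latin-affine⇒t*c≈0⇒t≡0 {s} {r} {c} {M} L A {t} t<n tc≈0 =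
    trans (sym (toℕ-fromℕ< t<n)) (trans (cong toℕ (LatinSquare.rowInj L fin₀ j fin₀ Mj≡M₀)) toℕ-fin₀)
    where
      j : Fin n
      j = fromℕ< t<n
      a : ℤ
      a = s + + toℕ fin₀ * r
      Mj≡M₀ : M fin₀ j ≡ M fin₀ fin₀
      Mj≡M₀ = symbol-≈⇒≡ (LatinSquare.inRange L fin₀ j) (LatinSquare.inRange L fin₀ fin₀) (begin
        + M fin₀ j             ≈⟨ Affine.entry A fin₀ j ⟩
        a + + toℕ j * c        ≡⟨ cong (λ k → a + + k * c) (toℕ-fromℕ< t<n) ⟩
        a + + t * c            ≈⟨ +-cong (≈-refl {x = a}) tc≈0 ⟩
        a + 0ℤ                 ≡⟨ ℤP.+-identityʳ a ⟩
        a                      ≡⟨ zero-term fin₀ toℕ-fin₀ ⟩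
        a + + toℕ fin₀ * c     ≈⟨ ≈-sym (Affine.entry A fin₀ fin₀) ⟩
        + M fin₀ fin₀          ∎)
        where open ≈-Reasoning

  HasSymmetry : Symmetry → Square n → Set
  HasSymmetry circulant     = Circulant n
  HasSymmetry backCirculant = BackCirculant n

  rowSlope : Symmetry → ℤ → ℤ
  rowSlope circulant     c = - c
  rowSlope backCirculant c = c

  rowSlope-cong : ∀ σ {x y} → x ≈ y → rowSlope σ x ≈ rowSlope σ y
  rowSlope-cong circulant     = -‿cong
  rowSlope-cong backCirculant x≈y = x≈y

  ‖rowSlope‖ : ∀ σ c → ‖ rowSlope σ c ‖ ≡ ‖ c ‖
  ‖rowSlope‖ circulant     = ‖-x‖≡‖x‖
  ‖rowSlope‖ backCirculant _ = refl

  rowSlope-square≈1 : ∀ σ {c} → c * c ≈ 1ℤ → rowSlope σ c * rowSlope σ c ≈ 1ℤ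
  rowSlope-square≈1 circulant {c} = neg-square≈1 {c}
  rowSlope-square≈1 backCirculant c²≈1 = c²≈1

  affine⇒symmetry : ∀ σ {s c M} → InRange M → Affine s (rowSlope σ c) c M → HasSymmetry σ M
  affine⇒symmetry circulant {c = c} {M} symbols A = diagonal , wrapped
    where
      cancel : ∀ {x y} → x ≈ y + c → x + - c ≈ y
      cancel {x} {y} x≈y+c = ≈-sym (+-moveʳ (≈-sym x≈y+c))
      diagonal : ∀ i i' j j' → toℕ i' ≡ suc (toℕ i) → toℕ j' ≡ suc (toℕ j) →
                 M i' j' ≡ M i j
      diagonal i i' j j' i'≡1+i j'≡1+j = symbol-≈⇒≡ (symbols i' j') (symbols i j)
        (≈-trans (progression-step (Affine.column A j') i'≡1+i)
                 (cancel (progression-step (Affine.row A i) j'≡1+j)))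
      wrapped : ∀ i i' j₁ jₙ → toℕ i' ≡ suc (toℕ i) → toℕ j₁ ≡ 0 → toℕ jₙ ≡ n ∸ 1 →
                M i' j₁ ≡ M i jₙ
      wrapped i i' j₁ jₙ i'≡1+i j₁≡0 jₙ≡n-1 = symbol-≈⇒≡ (symbols i' j₁) (symbols i jₙ)
        (≈-trans (progression-step (Affine.column A j₁) i'≡1+i)
                 (cancel (≈-sym (progression-wrap (Affine.row A i) j₁≡0 jₙ≡n-1))))
  affine⇒symmetry backCirculant {M = M} symbols A = antidiagonal , wrapped
    where
      antidiagonal : ∀ i i' j j' → toℕ i' ≡ suc (toℕ i) → toℕ j' ≡ suc (toℕ j) →
                     M i' j ≡ M i j'
      antidiagonal i i' j j' i'≡1+i j'≡1+j = symbol-≈⇒≡ (symbols i' j) (symbols i j')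
        (≈-trans (progression-step (Affine.column A j) i'≡1+i)
                 (≈-sym (progression-step (Affine.row A i) j'≡1+j)))
      wrapped : ∀ i i' j₁ jₙ → toℕ i' ≡ suc (toℕ i) → toℕ j₁ ≡ 0 → toℕ jₙ ≡ n ∸ 1 →
                M i' jₙ ≡ M i j₁
      wrapped i i' j₁ jₙ i'≡1+i j₁≡0 jₙ≡n-1 = symbol-≈⇒≡ (symbols i' jₙ) (symbols i j₁)
        (≈-trans (progression-step (Affine.column A jₙ) i'≡1+i)
                 (progression-wrap (Affine.row A i) j₁≡0 jₙ≡n-1))

  symmetry-of : ∀ {M} → Circulant n M ⊎ BackCirculant n M → ∃ λ σ → HasSymmetry σ M
  symmetry-of (inj₁ circ) = circulant , circ
  symmetry-of (inj₂ back) = backCirculant , back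

  toℕ≡0⇒≡fin₀ : ∀ {j} → toℕ j ≡ 0 → j ≡ fin₀
  toℕ≡0⇒≡fin₀ j≡0 = toℕ-injective (trans j≡0 (sym toℕ-fin₀))

  slope : Square n → ℕ
  slope M = hDiff n M fin₀ fin₀ fin₁

  slope<n : ∀ M → slope M < n
  slope<n M = m%n<n _ n

  symmetry-rowProduct⇒hDiff-shift : ∀ σ {M} → HasSymmetry σ M → RowProduct n M →
                                    ∀ j j' j'' → toℕ j' ≡ suc (toℕ j) → toℕ j'' ≡ suc (toℕ j') →
                                    hDiff n M fin₀ j' j'' ≡ hDiff n M fin₀ j j'
  symmetry-rowProduct⇒hDiff-shift circulant (diagonal , _) rp j j' j'' j'≡1+j j''≡1+j' =
    trans (rp fin₀ fin₁ j' j'' j''≡1+j')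
          (cong₂ (λ a b → resDiff n a b) (diagonal fin₀ fin₁ j' j'' toℕ-fin₁ j''≡1+j')
                                          (diagonal fin₀ fin₁ j j' toℕ-fin₁ j'≡1+j))
  symmetry-rowProduct⇒hDiff-shift backCirculant (antidiagonal , _) rp j j' j'' j'≡1+j j''≡1+j' =
    trans (cong₂ (λ a b → resDiff n a b) (sym (antidiagonal fin₀ fin₁ j' j'' toℕ-fin₁ j''≡1+j'))
                                          (sym (antidiagonal fin₀ fin₁ j j' toℕ-fin₁ j'≡1+j)))
          (rp fin₁ fin₀ j j' j'≡1+j)

  symmetry-rowProduct⇒hDiff≡slope : ∀ σ {M} → HasSymmetry σ M → RowProduct n M →
                                    ∀ i {j j'} → toℕ j' ≡ suc (toℕ j) → hDiff n M i j j' ≡ slope M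
  symmetry-rowProduct⇒hDiff≡slope σ {M} symmetric rp i {j} {j'} j'≡1+j =
    trans (rp i fin₀ j j' j'≡1+j) (firstRow j j' j'≡1+j)
    where
      firstRow : ∀ j j' → toℕ j' ≡ suc (toℕ j) → hDiff n M fin₀ j j' ≡ slope M
      firstRow = Fin-induction (λ j → ∀ j' → toℕ j' ≡ suc (toℕ j) → hDiff n M fin₀ j j' ≡ slope M)
        (λ j j≡0 j' j'≡1+j → cong₂ (hDiff n M fin₀) (toℕ≡0⇒≡fin₀ j≡0)
          (toℕ-injective (trans j'≡1+j (trans (cong (suc ∘ toℕ) (toℕ≡0⇒≡fin₀ j≡0)) (sym toℕ-fin₁)))))
        (λ j j' j'≡1+j ih j'' j''≡1+j' →
          trans (symmetry-rowProduct⇒hDiff-shift σ symmetric rp j j' j'' j'≡1+j j''≡1+j') (ih j' j'≡1+j))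

  symmetry-rowProduct⇒affine : ∀ σ {M} → InRange M → HasSymmetry σ M → RowProduct n M →
                               Affine (+ M fin₀ fin₀) (rowSlope σ (+ slope M)) (+ slope M) M
  symmetry-rowProduct⇒affine σ {M} symbols symmetric rp =
    affine λ i j → ≈-trans (term (rows i) j) (+-cong (term firstColumn i) (≈-refl {x = + toℕ j * d}))
    where
      d : ℤ
      d = + slope M
      rows : ∀ i → Progression (M i) (+ M i fin₀) d
      rows i = progression-by-steps
        (λ j j≡0 → ≈-reflexive (cong (λ k → + M i k) (toℕ≡0⇒≡fin₀ j≡0)))
        (λ j j' j'≡1+j → resDiff-step (proj₂ (symbols i j))
                                        (symmetry-rowProduct⇒hDiff≡slope σ symmetric rp i j'≡1+j))
      columnStep : ∀ σ → HasSymmetry σ M →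
                   ∀ i i' → toℕ i' ≡ suc (toℕ i) → + M i' fin₀ ≈ + M i fin₀ + rowSlope σ d
      columnStep circulant (_ , wrapped) i i' i'≡1+i = ≈-trans
        (≈-reflexive (cong +_ (wrapped i i' fin₀ finLast i'≡1+i toℕ-fin₀ toℕ-finLast)))
        (+-moveʳ {c = d} (progression-wrap (rows i) toℕ-fin₀ toℕ-finLast))
      columnStep backCirculant (antidiagonal , _) i i' i'≡1+i = ≈-trans
        (≈-reflexive (cong +_ (antidiagonal i i' fin₀ fin₁ i'≡1+i toℕ-fin₁)))
        (progression-step (rows i) toℕ-fin₁)
      firstColumn : Progression (λ i → M i fin₀) (+ M fin₀ fin₀) (rowSlope σ d)
      firstColumn = progression-by-steps
        (λ i i≡0 → ≈-reflexive (cong (λ k → + M k fin₀) (toℕ≡0⇒≡fin₀ i≡0)))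
        (columnStep σ symmetric)

  affineSquare : ℤ → ℤ → Square n
  affineSquare r c i j = suc ((+ toℕ i * r + + toℕ j * c) %ℕ n)

  affineSquare-inRange : ∀ r c → InRange (affineSquare r c)
  affineSquare-inRange r c i j = s≤s z≤n , n%ℕd<d (+ toℕ i * r + + toℕ j * c) n

  affineSquare-affine : ∀ r c → Affine 1ℤ r c (affineSquare r c)
  affineSquare-affine r c = affine λ i j →
    ≈-trans (+-cong (≈-refl {x = 1ℤ}) (%ℕ-≈ (+ toℕ i * r + + toℕ j * c)))
            (≈-reflexive (sym (ℤP.+-assoc 1ℤ (+ toℕ i * r) (+ toℕ j * c))))

  affineSquares-distinct : ∀ {r c r' c'} → ¬ c ≈ c' → ¬ affineSquare r c ≈S affineSquare r' c'
  affineSquares-distinct {r} {c} {r'} {c'} c≉c' same = c≉c'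
    (affine-≈S⇒slope≈ (affineSquare-inRange r c) (affineSquare-inRange r' c')
                      (affineSquare-affine r c) (affineSquare-affine r' c') same)

  Admissible : Symmetry → ℕ → Square n → Set
  Admissible σ K M =
    LatinSquare n M × HasSymmetry σ M × InnerDistance n M K × TopLeftOne n M × RowProduct n M

  affineSquare-admissible : ∀ σ {c} → c * c ≈ 1ℤ →
                            Admissible σ ‖ c ‖ (affineSquare (rowSlope σ c) c)
  affineSquare-admissible σ {c} c²≈1 =
    affine-latin symbols A (rowSlope σ c , rowSlope-square≈1 σ c²≈1) (c , c²≈1) ,
    affine⇒symmetry σ symbols A ,
    affine-innerDistance symbols A (‖rowSlope‖ σ c) ,
    affine-topLeft symbols A ,
    affine⇒rowProduct symbols A
    where
      symbols : InRange (affineSquare (rowSlope σ c) c)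
      symbols = affineSquare-inRange (rowSlope σ c) c
      A : Affine 1ℤ (rowSlope σ c) c (affineSquare (rowSlope σ c) c)
      A = affineSquare-affine (rowSlope σ c) c

  admissible⇒affine : ∀ σ {K M} → Admissible σ K M →
                      Affine 1ℤ (rowSlope σ (+ slope M)) (+ slope M) M
  admissible⇒affine σ {M = M} (L , symmetric , _ , topLeft , rp) =
    subst (λ s → Affine s (rowSlope σ (+ slope M)) (+ slope M) M)
          (cong +_ (topLeft fin₀ fin₀ toℕ-fin₀ toℕ-fin₀))
          (symmetry-rowProduct⇒affine σ (LatinSquare.inRange L) symmetric rp)

  admissible⇒‖slope‖ : ∀ σ {K M} → Admissible σ K M → ‖ + slope M ‖ ≡ K
  admissible⇒‖slope‖ σ {M = M} admissible@(L , _ , innerDistance , _) =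
    innerDistance-affine (LatinSquare.inRange L) (admissible⇒affine σ admissible)
                         (‖rowSlope‖ σ (+ slope M)) innerDistance

  admissible-unique : ∀ σ {K M c} → Admissible σ K M → + slope M ≈ c →
                      M ≈S affineSquare (rowSlope σ c) c
  admissible-unique σ {c = c} admissible@(L , _) slope≈c =
    affine-unique (LatinSquare.inRange L) (affineSquare-inRange (rowSlope σ c) c)
                  (admissible⇒affine σ admissible) (affineSquare-affine (rowSlope σ c) c)
                  ≈-refl (rowSlope-cong σ slope≈c) slope≈c

residue-decomposition : ∀ n r → n % 4 ≡ r → n ≡ r ℕ.+ n / 4 ℕ.* 4
residue-decomposition n r n%4≡r = trans (m≡m%n+[m/n]*n n 4) (cong (ℕ._+ n / 4 ℕ.* 4) n%4≡r)

multiple-of-4 : ∀ n .{{_ : NonZero n}} → n % 4 ≡ 0 → ∃ λ p → n ≡ 4 ℕ.+ p ℕ.* 4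
multiple-of-4 n n%4≡0 with n / 4 | residue-decomposition n 0 n%4≡0
... | zero  | n≡0 = ⊥-elim (ℕ.≢-nonZero⁻¹ n n≡0)
... | suc p | n≡  = p , n≡

module Order≡2mod4 (n : ℕ) .{{_ : NonZero n}} (q : ℕ) (n≡ : n ≡ 2 ℕ.+ q ℕ.* 4) where
  open Modulo n
  open Squares n (subst (1 <_) (sym n≡) (s≤s (s≤s z≤n)))

  half : ℕ
  half = 1 ℕ.+ q ℕ.* 2

  half<n : half < n
  half<n = subst (half <_) (sym n≡) (s≤s (s≤s (ℕP.*-monoʳ-≤ q (s≤s (s≤s z≤n)))))

  innerDistance≡ : n / 2 ∸ 1 ≡ q ℕ.* 2
  innerDistance≡ = cong (_∸ 1) (trans (/-congˡ (trans n≡ (double q))) (m*n/n≡m half 2))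
    where
      double : ∀ q → 2 ℕ.+ q ℕ.* 4 ≡ (1 ℕ.+ q ℕ.* 2) ℕ.* 2
      double = ℕ-Solver.solve-∀

  half*slope≈0 : ∀ {d} → d ≡ q ℕ.* 2 ⊎ d ℕ.+ q ℕ.* 2 ≡ n → + half * + d ≈ 0ℤ
  half*slope≈0 (inj₁ refl) = product≈0 {half} {q ℕ.* 2} q (trans (lower q) (cong (q ℕ.*_) (sym n≡)))
    where
      lower : ∀ q → (1 ℕ.+ q ℕ.* 2) ℕ.* (q ℕ.* 2) ≡ q ℕ.* (2 ℕ.+ q ℕ.* 4)
      lower = ℕ-Solver.solve-∀
  half*slope≈0 {d} (inj₂ d+2q≡n) = subst (λ d → + half * + d ≈ 0ℤ) (sym d≡2+2q)
    (product≈0 {half} {2 ℕ.+ q ℕ.* 2} (suc q) (trans (upper q) (cong (suc q ℕ.*_) (sym n≡))))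
    where
      split : ∀ q → 2 ℕ.+ q ℕ.* 4 ≡ (2 ℕ.+ q ℕ.* 2) ℕ.+ q ℕ.* 2
      split = ℕ-Solver.solve-∀
      d≡2+2q : d ≡ 2 ℕ.+ q ℕ.* 2
      d≡2+2q = ℕP.+-cancelʳ-≡ (q ℕ.* 2) d (2 ℕ.+ q ℕ.* 2) (trans d+2q≡n (trans n≡ (split q)))
      upper : ∀ q → (1 ℕ.+ q ℕ.* 2) ℕ.* (2 ℕ.+ q ℕ.* 2) ≡ suc q ℕ.* (2 ℕ.+ q ℕ.* 4)
      upper = ℕ-Solver.solve-∀

  noRowProduct : (M : Square n) → LatinSquare n M → Circulant n M ⊎ BackCirculant n M →
                 InnerDistance n M (n / 2 ∸ 1) → ¬ RowProduct n M
  noRowProduct M L circulantOrBack innerDistance rp =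
    half≢0 (latin-affine⇒t*c≈0⇒t≡0 L A half<n (half*slope≈0 (‖+d‖≡⇒ (slope<n M) ‖slope‖≡2q)))
    where
      σ : Symmetry
      σ = proj₁ (symmetry-of circulantOrBack)
      A : Affine (+ M fin₀ fin₀) (rowSlope σ (+ slope M)) (+ slope M) M
      A = symmetry-rowProduct⇒affine σ (LatinSquare.inRange L) (proj₂ (symmetry-of circulantOrBack)) rp
      ‖slope‖≡2q : ‖ + slope M ‖ ≡ q ℕ.* 2
      ‖slope‖≡2q = trans (innerDistance-affine (LatinSquare.inRange L) A (‖rowSlope‖ σ (+ slope M))
                                               innerDistance)
                         innerDistance≡
      half≢0 : ¬ half ≡ 0
      half≢0 ()

module Order≡0mod4 (n : ℕ) .{{_ : NonZero n}} (p : ℕ) (n≡ : n ≡ 4 ℕ.+ p ℕ.* 4) where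
  open Modulo n
  open Squares n (subst (1 <_) (sym n≡) (s≤s (s≤s z≤n)))

  k : ℕ
  k = 1 ℕ.+ p ℕ.* 2

  κ : ℤ
  κ = + k

  n≡k+[2+k] : n ≡ k ℕ.+ (2 ℕ.+ k)
  n≡k+[2+k] = trans n≡ (split p)
    where
      split : ∀ p → 4 ℕ.+ p ℕ.* 4 ≡ (1 ℕ.+ p ℕ.* 2) ℕ.+ (2 ℕ.+ (1 ℕ.+ p ℕ.* 2))
      split = ℕ-Solver.solve-∀

  k<n : k < n
  k<n = subst (k <_) (sym n≡k+[2+k]) (ℕP.m<m+n k (s≤s z≤n))

  innerDistance≡ : n / 2 ∸ 1 ≡ k
  innerDistance≡ = cong (_∸ 1) (trans (/-congˡ (trans n≡ (double p))) (m*n/n≡m (2 ℕ.+ p ℕ.* 2) 2))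
    where
      double : ∀ p → 4 ℕ.+ p ℕ.* 4 ≡ (2 ℕ.+ p ℕ.* 2) ℕ.* 2
      double = ℕ-Solver.solve-∀

  ‖κ‖≡ : ‖ κ ‖ ≡ n / 2 ∸ 1
  ‖κ‖≡ = trans (‖+d‖ (s≤s z≤n) k<n) (trans (ℕP.m≤n⇒m⊓n≡m k≤n∸k) (sym innerDistance≡))
    where
      k≤n∸k : k ≤ n ∸ k
      k≤n∸k = subst (k ≤_) (sym (trans (cong (_∸ k) n≡k+[2+k]) (ℕP.m+n∸m≡n k (2 ℕ.+ k))))
                    (ℕP.m≤n+m k 2)

  κ²≈1 : κ * κ ≈ 1ℤ
  κ²≈1 = by-quotient (+ p) (begin
    κ * κ               ≡⟨ sym (ℤP.pos-* k k) ⟩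
    + (k ℕ.* k)         ≡⟨ cong +_ (trans (square p) (cong (λ m → 1 ℕ.+ p ℕ.* m) (sym n≡))) ⟩
    + (1 ℕ.+ p ℕ.* n)   ≡⟨ cong (_+_ 1ℤ) (ℤP.pos-* p n) ⟩
    1ℤ + + p * + n      ∎)
    where
      open ≡-Reasoning
      square : ∀ p → (1 ℕ.+ p ℕ.* 2) ℕ.* (1 ℕ.+ p ℕ.* 2) ≡ 1 ℕ.+ p ℕ.* (4 ℕ.+ p ℕ.* 4)
      square = ℕ-Solver.solve-∀

  κ≉-κ : ¬ κ ≈ - κ
  κ≉-κ κ≈-κ = 2k≢0 (<n-≈⇒≡ 2k<n (ℕP.<-trans (s≤s z≤n) k<n)
    (≈-trans (+-cong κ≈-κ (≈-refl {x = κ})) (≈-reflexive (ℤP.+-inverseˡ κ))))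
    where
      2k<n : k ℕ.+ k < n
      2k<n = subst (k ℕ.+ k <_) (sym n≡k+[2+k]) (ℕP.+-monoʳ-< k (ℕP.m<n+m k {2} (s≤s z≤n)))
      2k≢0 : ¬ k ℕ.+ k ≡ 0
      2k≢0 ()

  slope-dichotomy : ∀ {d} → d ≡ k ⊎ d ℕ.+ k ≡ n → + d ≈ κ ⊎ + d ≈ - κ
  slope-dichotomy (inj₁ refl)  = inj₁ ≈-refl
  slope-dichotomy (inj₂ d+k≡n) =
    inj₂ (≈-trans (+-moveʳ {c = κ} (≈-trans (≈-reflexive (cong +_ d+k≡n)) modulus≈0))
                  (≈-reflexive (ℤP.+-identityˡ (- κ))))

  exactlyTwo : ∀ σ → ExactlyTwo n (Admissible σ (n / 2 ∸ 1))
  exactlyTwo σ =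
    affineSquare (rowSlope σ κ) κ , affineSquare (rowSlope σ (- κ)) (- κ) ,
    subst (λ K → Admissible σ K (affineSquare (rowSlope σ κ) κ)) ‖κ‖≡
          (affineSquare-admissible σ κ²≈1) ,
    subst (λ K → Admissible σ K (affineSquare (rowSlope σ (- κ)) (- κ))) (trans (‖-x‖≡‖x‖ κ) ‖κ‖≡)
          (affineSquare-admissible σ (neg-square≈1 {κ} κ²≈1)) ,
    affineSquares-distinct κ≉-κ ,
    λ M admissible → map (admissible-unique σ admissible) (admissible-unique σ admissible)
      (slope-dichotomy (‖+d‖≡⇒ (slope<n M) (trans (admissible⇒‖slope‖ σ admissible) innerDistance≡)))

mainTheorem13 : (n : ℕ) .{{_ : NonZero n}} → 6 ≤ n → 2 ∣ n →
    (n % 4 ≡ 2 → (M : Square n) → LatinSquare n M →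
       (Circulant n M ⊎ BackCirculant n M) →
       InnerDistance n M (n / 2 ∸ 1) → ¬ RowProduct n M)
    × (n % 4 ≡ 0 →
       ExactlyTwo n (λ M → LatinSquare n M × Circulant n M ×
         InnerDistance n M (n / 2 ∸ 1) × TopLeftOne n M × RowProduct n M)
       × ExactlyTwo n (λ M → LatinSquare n M × BackCirculant n M ×
         InnerDistance n M (n / 2 ∸ 1) × TopLeftOne n M × RowProduct n M))
mainTheorem13 n _ _ =
  (λ n%4≡2 → Order≡2mod4.noRowProduct n (n / 4) (residue-decomposition n 2 n%4≡2)) ,
  (λ n%4≡0 → let p , n≡ = multiple-of-4 n n%4≡0 in
    Order≡0mod4.exactlyTwo n p n≡ circulant , Order≡0mod4.exactlyTwo n p n≡ backCirculant)
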